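{- Let $n$ be a positive integer. Then $\sigma(n) = 2n - 1$ if and only if $$\frac{2n}{n + 1} \leq \frac{\sigma(n)}{n} < \frac{2n + 1}{n + 1}.$$
   Context: $\sigma(n)$ denotes the sum of all positive divisors of $n$. The quantity $\sigma(n)/n$ is called the abundancy index of $n$. A positive integer $n$ is called almost perfect if $\sigma(n) = 2n-1$. -}

module Defs where

open import Data.Nat using (ℕ; suc; _+_)
open import Data.Nat.Divisibility using (_∣?_)
open import Data.List using (List; filter; upTo; map)
open import Data.Nat.ListAction using (sum)

divisors : ℕ → List ℕ
divisors n = filter (_∣? n) (map suc (upTo n))

σ : ℕ → ℕ
σ n = sum (divisors n)

{-# OPTIONS --safe #-}
module Submission where

-- Clearing denominators, the two inequalities say 2n·n ≤ σ(n)·(n+1) < 2n·n + n.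
-- This window of length n < n+1 contains exactly one multiple of n+1, namely
-- (2n−1)(n+1) = 2n·n + (n−1), so it pins σ(n) down to 2n−1.  Nothing about σ
-- beyond being a natural number is used.

open import Defs
open import Data.Nat using (ℕ; suc; _*_; _+_; _∸_)
open import Data.Nat.Properties
  using (≤-reflexive; <-cmp; <⇒≱; ≤⇒≯; m≤m+n; m<m+n; *-monoˡ-≤; *-suc; module ≤-Reasoning)
open import Data.Nat.Tactic.RingSolver using (solve-∀)
import Data.Nat as ℕ
open import Data.Integer using (+_; +≤+; +<+)
import Data.Integer as ℤ
open import Data.Integer.Properties using (pos-*; drop‿+≤+; drop‿+<+)
open import Data.Rational using (_/_; _≤_; _<_; toℚᵘ)
open import Data.Rational.Properties using (toℚᵘ-fromℚᵘ; toℚᵘ-mono-≤; toℚᵘ-cancel-≤; toℚᵘ-mono-<; toℚᵘ-cancel-<)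
open import Data.Rational.Unnormalised using (mkℚᵘ; *≤*; *<*)
  renaming (_≤_ to _≤ᵘ_; _<_ to _<ᵘ_; _≃_ to _≃ᵘ_)
open import Data.Rational.Unnormalised.Properties
  using (≃-sym; ≤-respˡ-≃; ≤-respʳ-≃; <-respˡ-≃; <-respʳ-≃)
open import Data.Product using (_×_; _,_)
open import Data.Product.Function.NonDependent.Propositional using (_×-⇔_)
open import Function.Bundles using (_⇔_; mk⇔)
open import Function.Properties.Equivalence using () renaming (sym to ⇔-sym; trans to ⇔-trans)
open import Relation.Binary using (tri<; tri≈; tri>)
open import Relation.Binary.PropositionalEquality using (_≡_; refl; sym; trans; cong; subst; subst₂)
open import Relation.Nullary using (contradiction)

toℚᵘ-/ : ∀ a b → toℚᵘ (+ a / suc b) ≃ᵘ mkℚᵘ (+ a) b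
toℚᵘ-/ a b = toℚᵘ-fromℚᵘ (mkℚᵘ (+ a) b)

≤ᵘ-resp₂-⇔ : ∀ {p p′ q q′} → p ≃ᵘ p′ → q ≃ᵘ q′ → p ≤ᵘ q ⇔ p′ ≤ᵘ q′
≤ᵘ-resp₂-⇔ p≃p′ q≃q′ = mk⇔
  (λ p≤q → ≤-respʳ-≃ q≃q′ (≤-respˡ-≃ p≃p′ p≤q))
  (λ p′≤q′ → ≤-respʳ-≃ (≃-sym q≃q′) (≤-respˡ-≃ (≃-sym p≃p′) p′≤q′))

<ᵘ-resp₂-⇔ : ∀ {p p′ q q′} → p ≃ᵘ p′ → q ≃ᵘ q′ → p <ᵘ q ⇔ p′ <ᵘ q′
<ᵘ-resp₂-⇔ p≃p′ q≃q′ = mk⇔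
  (λ p<q → <-respʳ-≃ q≃q′ (<-respˡ-≃ p≃p′ p<q))
  (λ p′<q′ → <-respʳ-≃ (≃-sym q≃q′) (<-respˡ-≃ (≃-sym p≃p′) p′<q′))

mkℚᵘ-≤⇔ : ∀ a b c d → mkℚᵘ (+ a) b ≤ᵘ mkℚᵘ (+ c) d ⇔ a * suc d ℕ.≤ c * suc b
mkℚᵘ-≤⇔ a b c d = mk⇔
  (λ { (*≤* ad≤cb) → drop‿+≤+ (subst₂ ℤ._≤_ (sym (pos-* a (suc d))) (sym (pos-* c (suc b))) ad≤cb) })
  (λ ad≤cb → *≤* (subst₂ ℤ._≤_ (pos-* a (suc d)) (pos-* c (suc b)) (+≤+ ad≤cb)))

mkℚᵘ-<⇔ : ∀ a b c d → mkℚᵘ (+ a) b <ᵘ mkℚᵘ (+ c) d ⇔ a * suc d ℕ.< c * suc b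
mkℚᵘ-<⇔ a b c d = mk⇔
  (λ { (*<* ad<cb) → drop‿+<+ (subst₂ ℤ._<_ (sym (pos-* a (suc d))) (sym (pos-* c (suc b))) ad<cb) })
  (λ ad<cb → *<* (subst₂ ℤ._<_ (pos-* a (suc d)) (pos-* c (suc b)) (+<+ ad<cb)))

/-≤⇔ : ∀ a b c d → + a / suc b ≤ + c / suc d ⇔ a * suc d ℕ.≤ c * suc b
/-≤⇔ a b c d =
  ⇔-trans (mk⇔ toℚᵘ-mono-≤ toℚᵘ-cancel-≤)
  (⇔-trans (≤ᵘ-resp₂-⇔ (toℚᵘ-/ a b) (toℚᵘ-/ c d)) (mkℚᵘ-≤⇔ a b c d))

/-<⇔ : ∀ a b c d → + a / suc b < + c / suc d ⇔ a * suc d ℕ.< c * suc b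
/-<⇔ a b c d =
  ⇔-trans (mk⇔ toℚᵘ-mono-< toℚᵘ-cancel-<)
  (⇔-trans (<ᵘ-resp₂-⇔ (toℚᵘ-/ a b) (toℚᵘ-/ c d)) (mkℚᵘ-<⇔ a b c d))

2m+1-scaled : ∀ m → suc (2 * m) * (suc m + 1) ≡ 2 * suc m * suc m + m
2m+1-scaled = solve-∀

suc-2m+1-scaled : ∀ m → suc (suc (2 * m) * (suc m + 1)) ≡ (2 * suc m + 1) * suc m
suc-2m+1-scaled = solve-∀

2m-scaled : ∀ m → 2 * m * (suc m + 1) + 2 ≡ 2 * suc m * suc m
2m-scaled = solve-∀

2m+2-scaled : ∀ m → suc (suc (2 * m)) * (suc m + 1) ≡ (2 * suc m + 1) * suc m + suc m
2m+2-scaled = solve-∀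

module _ (m : ℕ) where

  private
    n = suc m

  InWindow : ℕ → Set
  InWindow s = 2 * n * n ℕ.≤ s * (n + 1) × s * (n + 1) ℕ.< (2 * n + 1) * n

  2n∸1≡2m+1 : 2 * n ∸ 1 ≡ suc (2 * m)
  2n∸1≡2m+1 = cong (_∸ 1) (*-suc 2 m)

  2m+1-inWindow : InWindow (suc (2 * m))
  2m+1-inWindow =
      subst (2 * n * n ℕ.≤_) (sym (2m+1-scaled m)) (m≤m+n (2 * n * n) m)
    , ≤-reflexive (suc-2m+1-scaled m)

  inWindow⇒≡2m+1 : ∀ s → InWindow s → s ≡ suc (2 * m)
  inWindow⇒≡2m+1 s (lower , upper) with <-cmp s (suc (2 * m))
  ... | tri≈ _ s≡2m+1 _ = s≡2m+1
  ... | tri< s<2m+1 _ _ = contradiction lower (<⇒≱ (begin-strict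
    s * (n + 1)               ≤⟨ *-monoˡ-≤ (n + 1) (ℕ.s≤s⁻¹ s<2m+1) ⟩
    2 * m * (n + 1)           <⟨ m<m+n _ (ℕ.s≤s ℕ.z≤n) ⟩
    2 * m * (n + 1) + 2       ≡⟨ 2m-scaled m ⟩
    2 * n * n                 ∎))
    where open ≤-Reasoning
  ... | tri> _ _ 2m+1<s = contradiction upper (≤⇒≯ (begin
    (2 * n + 1) * n               ≤⟨ m≤m+n _ n ⟩
    (2 * n + 1) * n + n           ≡⟨ 2m+2-scaled m ⟨
    suc (suc (2 * m)) * (n + 1)   ≤⟨ *-monoˡ-≤ (n + 1) 2m+1<s ⟩
    s * (n + 1)                   ∎))
    where open ≤-Reasoning

  ≡2n∸1⇔inWindow : ∀ s → s ≡ 2 * n ∸ 1 ⇔ InWindow s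
  ≡2n∸1⇔inWindow s = mk⇔
    (λ { refl → subst InWindow (sym 2n∸1≡2m+1) 2m+1-inWindow })
    (λ inWindow → trans (inWindow⇒≡2m+1 s inWindow) (sym 2n∸1≡2m+1))

theorem1 : (m : ℕ) → let n = suc m in
    (σ n ≡ 2 * n ∸ 1) ⇔
    (((+ (2 * n)) / (n + 1) ≤ (+ (σ n)) / n) × ((+ (σ n)) / n < (+ (2 * n + 1)) / (n + 1)))
theorem1 m =
  ⇔-trans (≡2n∸1⇔inWindow m (σ n))
    (⇔-sym (/-≤⇔ (2 * n) (m + 1) (σ n) m ×-⇔ /-<⇔ (σ n) m (2 * n + 1) (m + 1)))
  where n = suc m
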